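{- For every nGCL program $C$, $\mathsf{sp}[\![C]\!]$ is strict: $\mathsf{sp}[\![C]\!](-\infty)=-\infty$, where $-\infty$ denotes the constant quantity $\lambda\sigma.\,-\infty$.
   Context: Programs (nGCL) are generated by $C ::= \mathtt{skip} \mid x := e \mid C_1;C_2 \mid \mathtt{if}\,(\varphi)\,\{C_1\}\,\mathtt{else}\,\{C_2\} \mid \{C_1\}\,\square\,\{C_2\} \mid \mathtt{while}\,(\varphi)\,\{C\}$ ($\square$ is nondeterministic choice). A state $\sigma\in\Sigma$ maps each variable to a value in a fixed value domain $\mathbb{V}$; $\sigma(e)$ is the value of expression $e$, $\sigma\models\varphi$ means guard $\varphi$ holds, $\sigma[x\mapsto v]$ is the updated state. Quantities: $\mathbb{A}$ is the set of functions $\Sigma\to\mathbb{R}\cup\{ -\infty,+\infty\}$ ordered pointwise by $\preceq$; $\sqcap,\sqcup$ pointwise min/max. Extended Iverson bracket $[\varphi](\sigma)=+\infty$ if $\sigma\models\varphi$, else $-\infty$. $f[x/\alpha]:=\lambda\sigma.f(\sigma[x\mapsto\alpha])$ for $\alpha\in\mathbb{V}$; $\sup_\alpha$ pointwise over $\alpha\in\mathbb{V}$; $[x=e[x/\alpha]](\sigma)=+\infty$ iff $\sigma(x)=\sigma[x\mapsto\alpha](e)$, else $-\infty$. Strongest post $\mathsf{sp}[\![C]\!]:\mathbb{A}\to\mathbb{A}$: $\mathsf{sp}[\![\mathtt{skip}]\!](f)=f$; $\mathsf{sp}[\![x:=e]\!](f)=\sup_\alpha\,[x=e[x/\alpha]]\sqcap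 f[x/\alpha]$; $\mathsf{sp}[\![C_1;C_2]\!](f)=\mathsf{sp}[\![C_2]\!](\mathsf{sp}[\![C_1]\!](f))$; $\mathsf{sp}[\![\mathtt{if}(\varphi)\{C_1\}\mathtt{else}\{C_2\}]\!](f)=\mathsf{sp}[\![C_1]\!]([\varphi]\sqcap f)\sqcup\mathsf{sp}[\![C_2]\!]([\neg\varphi]\sqcap f)$; $\mathsf{sp}[\![\{C_1\}\square\{C_2\}]\!](f)=\mathsf{sp}[\![C_1]\!](f)\sqcup\mathsf{sp}[\![C_2]\!](f)$; $\mathsf{sp}[\![\mathtt{while}(\varphi)\{C\}]\!](f)=[\neg\varphi]\sqcap\big(\mathrm{lfp}\,X.\,f\sqcup\mathsf{sp}[\![C]\!]([\varphi]\sqcap X)\big)$, lfp in $(\mathbb{A},\preceq)$. -}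

module Defs where

open import Data.Product using (Σ; Σ-syntax; _,_; proj₁; _×_)
open import Data.Sum using (_⊎_)
open import Data.Bool using (Bool; true; false; if_then_else_)
open import Data.Empty using (⊥)
open import Relation.Nullary using (¬_; yes; no)
open import Relation.Binary.PropositionalEquality using (_≡_)
open import Relation.Binary.Definitions using (DecidableEquality)

record CompleteLinearOrder : Set₁ where
  field
    Carrier : Set
    _≤_     : Carrier → Carrier → Set
    ≤-refl  : ∀ {x} → x ≤ x
    ≤-trans : ∀ {x y z} → x ≤ y → y ≤ z → x ≤ z
    ≤-antisym : ∀ {x y} → x ≤ y → y ≤ x → x ≡ y
    ≤-total : ∀ x y → (x ≤ y) ⊎ (y ≤ x)
    ⨆ : {I : Set} → (I → Carrier) → Carrier
    ⨆-upper : ∀ {I} (f : I → Carrier) (i : I) → f i ≤ ⨆ f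
    ⨆-least : ∀ {I} (f : I → Carrier) (u : Carrier) → (∀ i → f i ≤ u) → ⨆ f ≤ u
    ⨅ : {I : Set} → (I → Carrier) → Carrier
    ⨅-lower : ∀ {I} (f : I → Carrier) (i : I) → ⨅ f ≤ f i
    ⨅-greatest : ∀ {I} (f : I → Carrier) (l : Carrier) → (∀ i → l ≤ f i) → l ≤ ⨅ f

  -∞ : Carrier
  -∞ = ⨆ {⊥} (λ ())

  +∞ : Carrier
  +∞ = ⨅ {⊥} (λ ())

  _⊔_ : Carrier → Carrier → Carrier
  x ⊔ y = ⨆ {Bool} (λ b → if b then x else y)

  _⊓_ : Carrier → Carrier → Carrier
  x ⊓ y = ⨅ {Bool} (λ b → if b then x else y)

-- nGCL syntax, over a type of variables Var and value domain V.
-- Expressions and guards are represented semantically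
-- (expressions : states → values, guards : states → propositions).
State : (Var V : Set) → Set
State Var V = Var → V

data Prog (Var V : Set) : Set₁ where
  skip   : Prog Var V
  _≔_    : Var → (State Var V → V) → Prog Var V
  _︔_    : Prog Var V → Prog Var V → Prog Var V
  ite_then_else_ : (State Var V → Set) → Prog Var V → Prog Var V → Prog Var V
  _□_    : Prog Var V → Prog Var V → Prog Var V
  while_loop_ : (State Var V → Set) → Prog Var V → Prog Var V

module Semantics (L : CompleteLinearOrder) {Var V : Set} (_≟_ : DecidableEquality Var) where
  open CompleteLinearOrder L

  Σ' : Set
  Σ' = State Var V

  𝔸 : Set
  𝔸 = Σ' → Carrier

  _≼_ : 𝔸 → 𝔸 → Set
  f ≼ g = ∀ σ → f σ ≤ g σ

  _⊓ₐ_ : 𝔸 → 𝔸 → 𝔸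
  (f ⊓ₐ g) σ = f σ ⊓ g σ

  _⊔ₐ_ : 𝔸 → 𝔸 → 𝔸
  (f ⊔ₐ g) σ = f σ ⊔ g σ

  ⊥ₐ : 𝔸
  ⊥ₐ _ = -∞

  upd : Σ' → Var → V → Σ'
  upd σ x v y with y ≟ x
  ... | yes _ = v
  ... | no  _ = σ y

  -- extended Iverson bracket of a proposition: +∞ if it holds, -∞ otherwise
  ⟦_⟧ᵖ : Set → Carrier
  ⟦ P ⟧ᵖ = ⨆ {P} (λ _ → +∞)

  [_] : (Σ' → Set) → 𝔸
  [ φ ] σ = ⟦ φ σ ⟧ᵖ

  ¬ᵍ : (Σ' → Set) → (Σ' → Set)
  ¬ᵍ φ σ = ¬ φ σ

  subst' : 𝔸 → Var → V → 𝔸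
  subst' f x α σ = f (upd σ x α)

  supV : (V → 𝔸) → 𝔸
  supV F σ = ⨆ {V} (λ α → F α σ)

  -- least fixed point in (𝔸, ≼) (Knaster–Tarski: meet of prefixed points)
  lfp : (𝔸 → 𝔸) → 𝔸
  lfp Φ σ = ⨅ {Σ[ X ∈ 𝔸 ] (Φ X ≼ X)} (λ p → proj₁ p σ)

  sp : Prog Var V → 𝔸 → 𝔸
  sp skip f = f
  sp (x ≔ e) f = supV (λ α → (λ σ → ⟦ σ x ≡ e (upd σ x α) ⟧ᵖ) ⊓ₐ subst' f x α)
  sp (C₁ ︔ C₂) f = sp C₂ (sp C₁ f)
  sp (ite φ then C₁ else C₂) f = sp C₁ ([ φ ] ⊓ₐ f) ⊔ₐ sp C₂ ([ ¬ᵍ φ ] ⊓ₐ f)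
  sp (C₁ □ C₂) f = sp C₁ f ⊔ₐ sp C₂ f
  sp (while φ loop C) f = [ ¬ᵍ φ ] ⊓ₐ lfp (λ X → f ⊔ₐ sp C ([ φ ] ⊓ₐ X))

module Submission where

open import Defs
open import Relation.Binary.PropositionalEquality using (_≡_)
open import Relation.Binary.Definitions using (DecidableEquality)
open import Data.Bool using (true; false)
open import Data.Product using (_,_)

module CompleteLinearOrderProperties (L : CompleteLinearOrder) where
  open CompleteLinearOrder L

  -∞-least : ∀ x → -∞ ≤ x
  -∞-least x = ⨆-least _ x (λ ())

  ⊓-≤ʳ : ∀ x y → (x ⊓ y) ≤ y
  ⊓-≤ʳ x y = ⨅-lower _ false

  ⊔-least : ∀ {x y u} → x ≤ u → y ≤ u → (x ⊔ y) ≤ u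
  ⊔-least {u = u} x≤u y≤u = ⨆-least _ u λ { true → x≤u ; false → y≤u }

module SemanticsProperties (L : CompleteLinearOrder) {Var V : Set} (_≟_ : DecidableEquality Var) where
  open CompleteLinearOrder L
  open CompleteLinearOrderProperties L
  open Semantics L {Var} {V} _≟_

  lfp-least : ∀ Φ {X} → Φ X ≼ X → lfp Φ ≼ X
  lfp-least Φ {X} ΦX≼X σ = ⨅-lower _ (X , ΦX≼X)

  ⊓ₐ-≼ʳ : ∀ f g → (f ⊓ₐ g) ≼ g
  ⊓ₐ-≼ʳ f g σ = ⊓-≤ʳ (f σ) (g σ)

  ⊔ₐ-least : ∀ {f g h} → f ≼ h → g ≼ h → (f ⊔ₐ g) ≼ h
  ⊔ₐ-least f≼h g≼h σ = ⊔-least (f≼h σ) (g≼h σ)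

  ≼-trans : ∀ {f g h} → f ≼ g → g ≼ h → f ≼ h
  ≼-trans f≼g g≼h σ = ≤-trans (f≼g σ) (g≼h σ)

  ≼-refl : ∀ {f} → f ≼ f
  ≼-refl σ = ≤-refl

  -- In the loop case ⊥ₐ is itself a prefixed point of the loop functional
  -- once f ≼ ⊥ₐ, so the least fixed point lies below it.
  sp-bottom : ∀ C {f} → f ≼ ⊥ₐ → sp C f ≼ ⊥ₐ
  sp-bottom skip f≼⊥ = f≼⊥
  sp-bottom (x ≔ e) f≼⊥ σ = ⨆-least _ -∞ λ α → ≤-trans (⊓-≤ʳ _ _) (f≼⊥ _)
  sp-bottom (C₁ ︔ C₂) f≼⊥ = sp-bottom C₂ (sp-bottom C₁ f≼⊥)
  sp-bottom (ite φ then C₁ else C₂) {f} f≼⊥ =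
    ⊔ₐ-least (sp-bottom C₁ (≼-trans (⊓ₐ-≼ʳ [ φ ] f) f≼⊥))
             (sp-bottom C₂ (≼-trans (⊓ₐ-≼ʳ [ ¬ᵍ φ ] f) f≼⊥))
  sp-bottom (C₁ □ C₂) f≼⊥ = ⊔ₐ-least (sp-bottom C₁ f≼⊥) (sp-bottom C₂ f≼⊥)
  sp-bottom (while φ loop C) {f} f≼⊥ =
    ≼-trans (⊓ₐ-≼ʳ [ ¬ᵍ φ ] _) (lfp-least _ ⊥ₐ-prefixed)
    where
      ⊥ₐ-prefixed : (f ⊔ₐ sp C ([ φ ] ⊓ₐ ⊥ₐ)) ≼ ⊥ₐ
      ⊥ₐ-prefixed = ⊔ₐ-least f≼⊥ (sp-bottom C (⊓ₐ-≼ʳ [ φ ] ⊥ₐ))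

mainTheorem12 : (L : CompleteLinearOrder) {Var V : Set} (_≟_ : DecidableEquality Var)
    (C : Prog Var V) (σ : State Var V) →
    Semantics.sp L _≟_ C (Semantics.⊥ₐ L _≟_) σ ≡ CompleteLinearOrder.-∞ L
mainTheorem12 L {Var} {V} _≟_ C σ =
  ≤-antisym (sp-bottom C ≼-refl σ) (-∞-least _)
  where
    open CompleteLinearOrder L
    open CompleteLinearOrderProperties L
    open SemanticsProperties L {Var} {V} _≟_
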